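{- Let $\mathcal B$ be a building set on a finite set $V$, and let $\mathcal N,\mathcal N'$ be inclusion-maximal $\mathcal B$-nested sets with $\mathcal N\setminus\{B\}=\mathcal N'\setminus\{B'\}$ for some blocks $B\neq B'$. Then $\{C\in\mathcal N:B\subsetneq C\}=\{C'\in\mathcal N':B'\subsetneq C'\}$.
   Context: A building set on $V$ is a set $\mathcal B$ of non-empty subsets of $V$ containing all singletons such that $B\cap B'\ne\varnothing$ implies $B\cup B'\in\mathcal B$; $\kappa(\mathcal B)$ is its set of inclusion-maximal blocks. A $\mathcal B$-nested set is $\mathcal N\subseteq\mathcal B$ whose members are pairwise nested or disjoint, such that no union of $k\ge2$ pairwise disjoint members belongs to $\mathcal B$, and with $\kappa(\mathcal B)\subseteq\mathcal N$. -}

module Defs where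

open import Data.Nat using (ℕ; _≥_)
open import Data.Fin using (Fin)
open import Data.Fin.Subset using (Subset; _⊆_; _∩_; _∪_; ⋃; ⁅_⁆; Nonempty; Empty)
open import Data.List using (List; length)
open import Data.List.Relation.Unary.All using (All)
open import Data.List.Relation.Unary.AllPairs using (AllPairs)
open import Data.Product using (_×_)
open import Data.Sum using (_⊎_)
open import Relation.Nullary using (¬_)
open import Relation.Binary.PropositionalEquality using (_≡_)
open import Level using (Level; suc; zero)

-- The ground set V is Fin n.  A family of subsets of V (e.g. a building
-- set, or a nested set) is a predicate on Subset n.
Family : ℕ → Set₁
Family n = Subset n → Set

module _ {n : ℕ} where

  _⊑_ : Family n → Family n → Set
  𝓐 ⊑ 𝓒 = ∀ X → 𝓐 X → 𝓒 X

  record IsBuildingSet (𝓑 : Family n) : Set where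
    field
      nonempty   : ∀ B → 𝓑 B → Nonempty B
      singletons : ∀ (i : Fin n) → 𝓑 ⁅ i ⁆
      union      : ∀ B B′ → 𝓑 B → 𝓑 B′ → Nonempty (B ∩ B′) → 𝓑 (B ∪ B′)

  κ : Family n → Family n
  κ 𝓑 B = 𝓑 B × (∀ C → 𝓑 C → B ⊆ C → C ≡ B)

  record IsNested (𝓑 𝓝 : Family n) : Set where
    field
      sub       : 𝓝 ⊑ 𝓑
      laminar   : ∀ X Y → 𝓝 X → 𝓝 Y → X ⊆ Y ⊎ (Y ⊆ X ⊎ Empty (X ∩ Y))
      nonUnion  : ∀ (Xs : List (Subset n)) → length Xs ≥ 2 → All 𝓝 Xs →
                  AllPairs (λ X Y → Empty (X ∩ Y)) Xs → ¬ 𝓑 (⋃ Xs)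
      maxBlocks : κ 𝓑 ⊑ 𝓝

  record IsMaximalNested (𝓑 𝓝 : Family n) : Set₁ where
    field
      nested  : IsNested 𝓑 𝓝
      maximal : ∀ (𝓜 : Family n) → IsNested 𝓑 𝓜 → 𝓝 ⊑ 𝓜 → 𝓜 ⊑ 𝓝

module Submission where

-- Let C ∈ 𝓝 with B ⊊ C. Then C ∈ 𝓝′, so C and B′ are comparable or disjoint.
-- If C ⊆ B′ or C ∩ B′ = ∅, then 𝓝 ∪ {B′} is still nested, contradicting the
-- maximality of 𝓝 since B′ ∉ 𝓝: laminarity and the union condition for
-- families avoiding B or B′ are inherited from 𝓝′ or 𝓝, and a forbidden
-- disjoint union containing both B and B′ is impossible when B ⊆ B′, while
-- when B′ ∩ C = ∅ replacing its members inside C by C gives a forbidden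
-- union in 𝓝′. Hence B′ ⊊ C; the converse is symmetric.

open import Defs
open import Data.Nat using (ℕ; _≥_; s≤s)
open import Data.Fin.Properties using (any?)
open import Data.Fin.Subset
  using (Subset; _∈_; _⊆_; _⊈_; _⊂_; _∩_; _∪_; ⋃; Nonempty; Empty)
open import Data.Fin.Subset.Properties
  using (_∈?_; _⊆?_; ⊆-refl; ⊂-irref; ⊆-trans; ⊆-antisym; ∩-comm; x∈p∩q⁺; x∈p∩q⁻; p⊆p∪q; q⊆p∪q; x∈p∪q⁻; ∉⊥)
import Data.Bool.Properties as Bool
open import Data.Vec.Properties using (≡-dec)
open import Data.List using (List; []; _∷_; length; filter)
open import Data.List.Relation.Unary.All as All using (All; []; _∷_)
import Data.List.Relation.Unary.All.Properties as Allₚ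
open import Data.List.Relation.Unary.AllPairs using (AllPairs; []; _∷_)
import Data.List.Relation.Unary.AllPairs.Properties as AllPairsₚ
open import Data.List.Relation.Unary.Any as Any using (Any; here; there)
open import Data.List.Membership.Propositional using (find; lose) renaming (_∈_ to _∈ₗ_)
open import Data.List.Membership.Propositional.Properties using (∈-filter⁺; ∈-filter⁻; ∈-length)
open import Data.Product using (_×_; _,_; proj₁; proj₂)
open import Data.Sum using (_⊎_; inj₁; inj₂)
open import Data.Empty using (⊥-elim)
open import Function using (_∘_)
open import Function.Bundles using (_⇔_; mk⇔; Equivalence)
open import Relation.Nullary using (¬_; Dec; yes; no; ¬?)
open import Relation.Nullary.Decidable using (decidable-stable; _×-dec_)
open import Relation.Unary using (｛_｝) renaming (_∪_ to _∪′_)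
open import Relation.Binary.Definitions using (DecidableEquality)
open import Relation.Binary.PropositionalEquality using (_≡_; _≢_; refl; sym; subst)

module _ {n : ℕ} where

  _≟ₛ_ : DecidableEquality (Subset n)
  _≟ₛ_ = ≡-dec Bool._≟_

  _⊈?_ : ∀ (X C : Subset n) → Dec (X ⊈ C)
  X ⊈? C = ¬? (X ⊆? C)

  Disjoint : Subset n → Subset n → Set
  Disjoint X Y = Empty (X ∩ Y)

  Disjoint-sym : ∀ {X Y : Subset n} → Disjoint X Y → Disjoint Y X
  Disjoint-sym {X} {Y} = subst Empty (∩-comm X Y)

  Laminar : Subset n → Subset n → Set
  Laminar X Y = X ⊆ Y ⊎ (Y ⊆ X ⊎ Disjoint X Y)

  Laminar-sym : ∀ {X Y : Subset n} → Laminar X Y → Laminar Y X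
  Laminar-sym (inj₁ X⊆Y)        = inj₂ (inj₁ X⊆Y)
  Laminar-sym (inj₂ (inj₁ Y⊆X)) = inj₁ Y⊆X
  Laminar-sym (inj₂ (inj₂ X#Y)) = inj₂ (inj₂ (Disjoint-sym X#Y))

  ⊆∧≢⇒⊂ : ∀ {X Y : Subset n} → X ⊆ Y → X ≢ Y → X ⊂ Y
  ⊆∧≢⇒⊂ {X} {Y} X⊆Y X≢Y with any? (λ x → (x ∈? Y) ×-dec ¬? (x ∈? X))
  ... | yes new = X⊆Y , new
  ... | no ¬new = ⊥-elim (X≢Y (⊆-antisym X⊆Y Y⊆X))
    where
    Y⊆X : Y ⊆ X
    Y⊆X {x} x∈Y = decidable-stable (x ∈? X) (λ x∉X → ¬new (x , x∈Y , x∉X))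

  PairwiseDisjoint : List (Subset n) → Set
  PairwiseDisjoint = AllPairs Disjoint

  x∈⋃⁺ : ∀ {x} {Xs : List (Subset n)} → Any (x ∈_) Xs → x ∈ ⋃ Xs
  x∈⋃⁺ {Xs = X ∷ Xs} (here x∈X)  = p⊆p∪q (⋃ Xs) x∈X
  x∈⋃⁺ {Xs = X ∷ Xs} (there x∈⋃) = q⊆p∪q X (⋃ Xs) (x∈⋃⁺ x∈⋃)

  x∈⋃⁻ : ∀ {x} (Xs : List (Subset n)) → x ∈ ⋃ Xs → Any (x ∈_) Xs
  x∈⋃⁻ []       x∈⊥ = ⊥-elim (∉⊥ x∈⊥)
  x∈⋃⁻ (X ∷ Xs) x∈⋃ with x∈p∪q⁻ X (⋃ Xs) x∈⋃
  ... | inj₁ x∈X  = here x∈X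
  ... | inj₂ x∈Xs = there (x∈⋃⁻ Xs x∈Xs)

  ∈⇒⊆⋃ : ∀ {X : Subset n} {Xs} → X ∈ₗ Xs → X ⊆ ⋃ Xs
  ∈⇒⊆⋃ X∈Xs x∈X = x∈⋃⁺ (lose X∈Xs x∈X)

  PairwiseDisjoint-meet⇒≡ : ∀ {Xs} {X Y : Subset n} → PairwiseDisjoint Xs →
    X ∈ₗ Xs → Y ∈ₗ Xs → Nonempty (X ∩ Y) → X ≡ Y
  PairwiseDisjoint-meet⇒≡ (_ ∷ _) (here refl) (here refl) _ = refl
  PairwiseDisjoint-meet⇒≡ (X# ∷ _) (here refl) (there Y∈) meet =
    ⊥-elim (All.lookup X# Y∈ meet)
  PairwiseDisjoint-meet⇒≡ (Y# ∷ _) (there X∈) (here refl) meet =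
    ⊥-elim (Disjoint-sym (All.lookup Y# X∈) meet)
  PairwiseDisjoint-meet⇒≡ (_ ∷ disjoint) (there X∈) (there Y∈) meet =
    PairwiseDisjoint-meet⇒≡ disjoint X∈ Y∈ meet

  module _ (C : Subset n) (Xs : List (Subset n)) where

    Outside : List (Subset n)
    Outside = filter (_⊈? C) Xs

    ⋃-absorb : ⋃ (C ∷ Outside) ≡ C ∪ ⋃ Xs
    ⋃-absorb = ⊆-antisym absorbed restored
      where
      absorbed : ⋃ (C ∷ Outside) ⊆ C ∪ ⋃ Xs
      absorbed {x} x∈ with x∈p∪q⁻ C (⋃ Outside) x∈
      ... | inj₁ x∈C = p⊆p∪q (⋃ Xs) x∈C
      ... | inj₂ x∈⋃ = let X , X∈ , x∈X = find (x∈⋃⁻ Outside x∈⋃) in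
        q⊆p∪q C (⋃ Xs) (∈⇒⊆⋃ (proj₁ (∈-filter⁻ (_⊈? C) {xs = Xs} X∈)) x∈X)

      member⊆⋃ : ∀ {X} → X ∈ₗ Xs → X ⊆ ⋃ (C ∷ Outside)
      member⊆⋃ {X} X∈ with X ⊆? C
      ... | yes X⊆C = p⊆p∪q (⋃ Outside) ∘ X⊆C
      ... | no  X⊈C = q⊆p∪q C (⋃ Outside) ∘ ∈⇒⊆⋃ (∈-filter⁺ (_⊈? C) X∈ X⊈C)

      restored : C ∪ ⋃ Xs ⊆ ⋃ (C ∷ Outside)
      restored {x} x∈ with x∈p∪q⁻ C (⋃ Xs) x∈
      ... | inj₁ x∈C = p⊆p∪q (⋃ Outside) x∈C
      ... | inj₂ x∈⋃ = let X , X∈ , x∈X = find (x∈⋃⁻ Xs x∈⋃) in member⊆⋃ X∈ x∈X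

    PairwiseDisjoint-absorb : PairwiseDisjoint Xs →
      All (λ X → X ⊆ C ⊎ Disjoint C X) Xs → PairwiseDisjoint (C ∷ Outside)
    PairwiseDisjoint-absorb disjoint inside⊎disjoint =
      All.zipWith outside⇒disjoint (Allₚ.all-filter (_⊈? C) Xs , Allₚ.filter⁺ (_⊈? C) inside⊎disjoint)
      ∷ AllPairsₚ.filter⁺ (_⊈? C) disjoint
      where
      outside⇒disjoint : ∀ {X} → X ⊈ C × (X ⊆ C ⊎ Disjoint C X) → Disjoint C X
      outside⇒disjoint (X⊈C , inj₁ X⊆C) = ⊥-elim (X⊈C X⊆C)
      outside⇒disjoint (_   , inj₂ C#X) = C#X

module _ {n : ℕ} {𝓑 𝓝 : Family n} where

  -- Trading the members of Xs inside C for C itself: C ∪ ⋃ Xs is a block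
  -- because C meets ⋃ Xs, and it is a disjoint union of at least two members of 𝓝.
  nonUnion-absorb : IsBuildingSet 𝓑 → IsNested 𝓑 𝓝 → ∀ {C Xs} → 𝓝 C →
    PairwiseDisjoint Xs → All (λ X → X ⊆ C ⊎ Disjoint C X) Xs →
    All (λ X → X ⊈ C → 𝓝 X) Xs → Any (_⊈ C) Xs →
    Nonempty (C ∩ ⋃ Xs) → ¬ 𝓑 (⋃ Xs)
  nonUnion-absorb building nested {C} {Xs} 𝓝C disjoint inside⊎disjoint outside⇒𝓝 outside meet 𝓑⋃ =
    IsNested.nonUnion nested (C ∷ Outside C Xs) (s≤s (∈-length X∈Outside))
      (𝓝C ∷ outsiders∈𝓝) (PairwiseDisjoint-absorb C Xs disjoint inside⊎disjoint)
      (subst 𝓑 (sym (⋃-absorb C Xs)) C∪⋃∈𝓑)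
    where
    X∈Outside : proj₁ (find outside) ∈ₗ Outside C Xs
    X∈Outside = ∈-filter⁺ (_⊈? C) (proj₁ (proj₂ (find outside))) (proj₂ (proj₂ (find outside)))
    outsiders∈𝓝 : All 𝓝 (Outside C Xs)
    outsiders∈𝓝 = All.zipWith (λ (X⊈C , ⊈⇒𝓝) → ⊈⇒𝓝 X⊈C)
      (Allₚ.all-filter (_⊈? C) Xs , Allₚ.filter⁺ (_⊈? C) outside⇒𝓝)
    C∪⋃∈𝓑 : 𝓑 (C ∪ ⋃ Xs)
    C∪⋃∈𝓑 = IsBuildingSet.union building C (⋃ Xs) (IsNested.sub nested C 𝓝C) 𝓑⋃ meet

  nested-insert : ∀ {𝓝′ : Family n} {B D} → IsNested 𝓑 𝓝 → IsNested 𝓑 𝓝′ → 𝓝′ D →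
    (∀ {X} → 𝓝 X → X ≢ B → 𝓝′ X) → Laminar B D →
    (∀ Xs → length Xs ≥ 2 → All (𝓝 ∪′ ｛ D ｝) Xs → PairwiseDisjoint Xs →
       B ∈ₗ Xs → D ∈ₗ Xs → ¬ 𝓑 (⋃ Xs)) →
    IsNested 𝓑 (𝓝 ∪′ ｛ D ｝)
  nested-insert {𝓝′} {B} {D} nested nested′ 𝓝′D 𝓝⊆𝓝′ B~D nonUnion-B-D = record
    { sub       = λ { X (inj₁ 𝓝X) → N.sub X 𝓝X ; X (inj₂ refl) → N′.sub D 𝓝′D }
    ; laminar   = laminar
    ; nonUnion  = nonUnion
    ; maxBlocks = λ X κX → inj₁ (N.maxBlocks X κX)
    }
    where
    module N  = IsNested nested
    module N′ = IsNested nested′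

    laminar-D : ∀ X → 𝓝 X → Laminar X D
    laminar-D X 𝓝X with X ≟ₛ B
    ... | yes refl = B~D
    ... | no  X≢B  = N′.laminar X D (𝓝⊆𝓝′ 𝓝X X≢B) 𝓝′D

    laminar : ∀ X Y → (𝓝 ∪′ ｛ D ｝) X → (𝓝 ∪′ ｛ D ｝) Y → Laminar X Y
    laminar X Y (inj₁ 𝓝X)  (inj₁ 𝓝Y)  = N.laminar X Y 𝓝X 𝓝Y
    laminar X _ (inj₁ 𝓝X)  (inj₂ refl) = laminar-D X 𝓝X
    laminar _ Y (inj₂ refl) (inj₁ 𝓝Y)  = Laminar-sym (laminar-D Y 𝓝Y)
    laminar _ _ (inj₂ refl) (inj₂ refl) = inj₁ ⊆-refl

    without-D : ∀ {Xs} → All (𝓝 ∪′ ｛ D ｝) Xs → ¬ D ∈ₗ Xs → All 𝓝 Xs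
    without-D []              _   = []
    without-D (inj₁ 𝓝X ∷ all) D∉ = 𝓝X ∷ without-D all (D∉ ∘ there)
    without-D (inj₂ refl ∷ _) D∉ = ⊥-elim (D∉ (here refl))

    without-B : ∀ {Xs} → All (𝓝 ∪′ ｛ D ｝) Xs → ¬ B ∈ₗ Xs → All 𝓝′ Xs
    without-B []              _   = []
    without-B (inj₁ 𝓝X ∷ all) B∉ =
      𝓝⊆𝓝′ 𝓝X (λ { refl → B∉ (here refl) }) ∷ without-B all (B∉ ∘ there)
    without-B (inj₂ refl ∷ all) B∉ = 𝓝′D ∷ without-B all (B∉ ∘ there)

    nonUnion : ∀ Xs → length Xs ≥ 2 → All (𝓝 ∪′ ｛ D ｝) Xs → PairwiseDisjoint Xs → ¬ 𝓑 (⋃ Xs)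
    nonUnion Xs ≥2 all disjoint with Any.any? (D ≟ₛ_) Xs | Any.any? (B ≟ₛ_) Xs
    ... | no  D∉ | _      = N.nonUnion Xs ≥2 (without-D all D∉) disjoint
    ... | yes _  | no  B∉ = N′.nonUnion Xs ≥2 (without-B all B∉) disjoint
    ... | yes D∈ | yes B∈ = nonUnion-B-D Xs ≥2 all disjoint B∈ D∈

module Exchange {n : ℕ} {𝓑 𝓝 𝓝′ : Family n} {B B′ : Subset n}
  (building : IsBuildingSet 𝓑) (maximal : IsMaximalNested 𝓑 𝓝) (nested′ : IsNested 𝓑 𝓝′)
  (B≢B′ : B ≢ B′) (𝓝B : 𝓝 B) (𝓝′B′ : 𝓝′ B′)
  (exchange : ∀ {X} → 𝓝 X → X ≢ B → 𝓝′ X × X ≢ B′) where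

  private
    module N  = IsNested (IsMaximalNested.nested maximal)
    module N′ = IsNested nested′

  B-nonempty : Nonempty B
  B-nonempty = IsBuildingSet.nonempty building B (N.sub B 𝓝B)

  B′-nonempty : Nonempty B′
  B′-nonempty = IsBuildingSet.nonempty building B′ (N′.sub B′ 𝓝′B′)

  B′∉𝓝 : ¬ 𝓝 B′
  B′∉𝓝 𝓝B′ = proj₂ (exchange 𝓝B′ (B≢B′ ∘ sym)) refl

  insert-B′-impossible : Laminar B B′ →
    ¬ (∀ Xs → length Xs ≥ 2 → All (𝓝 ∪′ ｛ B′ ｝) Xs → PairwiseDisjoint Xs →
         B ∈ₗ Xs → B′ ∈ₗ Xs → ¬ 𝓑 (⋃ Xs))
  insert-B′-impossible B~B′ nonUnion-B-B′ =
    B′∉𝓝 (IsMaximalNested.maximal maximal (𝓝 ∪′ ｛ B′ ｝) inserted (λ _ → inj₁) B′ (inj₂ refl))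
    where
    inserted : IsNested 𝓑 (𝓝 ∪′ ｛ B′ ｝)
    inserted = nested-insert (IsMaximalNested.nested maximal) nested′ 𝓝′B′
      (λ 𝓝X X≢B → proj₁ (exchange 𝓝X X≢B)) B~B′ nonUnion-B-B′

  B⊈B′ : B ⊈ B′
  B⊈B′ B⊆B′ = insert-B′-impossible (inj₁ B⊆B′) λ _ _ _ disjoint B∈ B′∈ _ →
    let x , x∈B = B-nonempty in
    B≢B′ (PairwiseDisjoint-meet⇒≡ disjoint B∈ B′∈ (x , x∈p∩q⁺ (x∈B , B⊆B′ x∈B)))

  superset-of-B-meets-B′ : ∀ {C} → 𝓝 C → 𝓝′ C → B ⊆ C → ¬ Disjoint B′ C
  superset-of-B-meets-B′ {C} 𝓝C 𝓝′C B⊆C B′#C = insert-B′-impossible (inj₂ (inj₂ B#B′)) forbidden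
    where
    B#B′ : Disjoint B B′
    B#B′ (x , x∈B∩B′) = let x∈B , x∈B′ = x∈p∩q⁻ B B′ x∈B∩B′ in
      B′#C (x , x∈p∩q⁺ (x∈B′ , B⊆C x∈B))

    B′⊈C : B′ ⊈ C
    B′⊈C B′⊆C = let x , x∈B′ = B′-nonempty in B′#C (x , x∈p∩q⁺ (x∈B′ , B′⊆C x∈B′))

    forbidden : ∀ Xs → length Xs ≥ 2 → All (𝓝 ∪′ ｛ B′ ｝) Xs → PairwiseDisjoint Xs →
      B ∈ₗ Xs → B′ ∈ₗ Xs → ¬ 𝓑 (⋃ Xs)
    forbidden Xs _ all disjoint B∈ B′∈ with B-nonempty
    ... | x , x∈B = nonUnion-absorb building nested′ 𝓝′C disjoint
        (All.tabulate inside⊎disjoint) (All.tabulate outside⇒𝓝′) (lose B′∈ B′⊈C)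
        (x , x∈p∩q⁺ (B⊆C x∈B , ∈⇒⊆⋃ B∈ x∈B))
      where
      inside⊎disjoint : ∀ {X} → X ∈ₗ Xs → X ⊆ C ⊎ Disjoint C X
      inside⊎disjoint {X} X∈ with All.lookup all X∈
      ... | inj₂ refl = inj₂ (Disjoint-sym B′#C)
      ... | inj₁ 𝓝X with N.laminar _ C 𝓝X 𝓝C
      ...   | inj₁ X⊆C        = inj₁ X⊆C
      ...   | inj₂ (inj₂ X#C) = inj₂ (Disjoint-sym X#C)
      ...   | inj₂ (inj₁ C⊆X) = inj₁ (subst (_⊆ C) B≡X B⊆C)
        where
        B≡X : B ≡ X
        B≡X = PairwiseDisjoint-meet⇒≡ disjoint B∈ X∈ (x , x∈p∩q⁺ (x∈B , C⊆X (B⊆C x∈B)))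

      outside⇒𝓝′ : ∀ {X} → X ∈ₗ Xs → X ⊈ C → 𝓝′ X
      outside⇒𝓝′ X∈ X⊈C with All.lookup all X∈
      ... | inj₂ refl = 𝓝′B′
      ... | inj₁ 𝓝X  = proj₁ (exchange 𝓝X λ { refl → X⊈C B⊆C })

  strict-superset : ∀ {C} → 𝓝 C → B ⊂ C → 𝓝′ C × B′ ⊂ C
  strict-superset {C} 𝓝C B⊂C@(B⊆C , _) with exchange 𝓝C (λ C≡B → ⊂-irref (sym C≡B) B⊂C)
  ... | 𝓝′C , C≢B′ with N′.laminar B′ C 𝓝′B′ 𝓝′C
  ...   | inj₁ B′⊆C        = 𝓝′C , ⊆∧≢⇒⊂ B′⊆C (C≢B′ ∘ sym)
  ...   | inj₂ (inj₁ C⊆B′) = ⊥-elim (B⊈B′ (⊆-trans B⊆C C⊆B′))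
  ...   | inj₂ (inj₂ B′#C) = ⊥-elim (superset-of-B-meets-B′ 𝓝C 𝓝′C B⊆C B′#C)

lemma3p12 : ∀ {n : ℕ} (𝓑 𝓝 𝓝′ : Family n) (B B′ : Subset n) →
    IsBuildingSet 𝓑 → IsMaximalNested 𝓑 𝓝 → IsMaximalNested 𝓑 𝓝′ →
    B ≢ B′ → 𝓝 B → 𝓝′ B′ →
    (∀ X → (𝓝 X × X ≢ B) ⇔ (𝓝′ X × X ≢ B′)) →
    ∀ C → (𝓝 C × B ⊂ C) ⇔ (𝓝′ C × B′ ⊂ C)
lemma3p12 𝓑 𝓝 𝓝′ B B′ building maximal maximal′ B≢B′ 𝓝B 𝓝′B′ exchange C =
  mk⇔ (λ (𝓝C , B⊂C) → Exchange.strict-superset building maximal nested′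
                         B≢B′ 𝓝B 𝓝′B′ to 𝓝C B⊂C)
      (λ (𝓝′C , B′⊂C) → Exchange.strict-superset building maximal′ nested
                           (B≢B′ ∘ sym) 𝓝′B′ 𝓝B from 𝓝′C B′⊂C)
  where
  nested : IsNested 𝓑 𝓝
  nested = IsMaximalNested.nested maximal
  nested′ : IsNested 𝓑 𝓝′
  nested′ = IsMaximalNested.nested maximal′
  to : ∀ {X} → 𝓝 X → X ≢ B → 𝓝′ X × X ≢ B′
  to 𝓝X X≢B = Equivalence.to (exchange _) (𝓝X , X≢B)
  from : ∀ {X} → 𝓝′ X → X ≢ B′ → 𝓝 X × X ≢ B
  from 𝓝′X X≢B′ = Equivalence.from (exchange _) (𝓝′X , X≢B′)
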